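{- Let $S^0 = \{1, \ldots, n\}$ for some $n$ and let $S^0, S^1, \ldots$ be the aggregate chain. Then with one-sided greedy routing, every $S^t$ is either $\{0\}$ or of the form $\{1, \ldots, k\}$ for some $k$; and with two-sided greedy routing, every $S^t$ is an interval of integers in which every element has the same sign.
   Context: Nodes are labeled by the integers and the routing target is $0$. A link-offset set $\Delta$ is a random finite set of nonzero integers, always containing $-1$ and $+1$; a node $x$ with offset set $\Delta$ has outgoing links to $x - \delta$ for $\delta \in \Delta$. Write the elements of $\Delta$ as $\Delta_{ -s} < \cdots < \Delta_{ -1} = -1 < \Delta_1 = 1 < \cdots < \Delta_t$. Successor function $s(x,\Delta)$: in one-sided greedy routing, from $x$ the message moves to the node $x - \Delta_i$ with the smallest non-negative label; in two-sided greedy routing it moves to a node $x - \Delta_i$ whose label has smallest absolute value, ties broken by a fixed arbitrary rule. Aggregate chain: for a set $S$ of consecutive integers of common sign and a set $\Delta$, let $S_{\Delta i} = \{x \in S : s(x,\Delta) = x - \Delta_i\}$ and for $\sigma \in \{ -,0,+\}$ let $S_{\Delta i\sigma} = \{x \in S_{\Delta i} : \operatorname{sgn} s(x,\Delta) = \sigma\}$; $A - \delta = \{x-\delta : x\in A\}$. If $S^t = \{0\}$ then $S^{t+1} = \{0\}$; otherwise a fresh $\Delta$ is drawn and, conditioned on $\Delta$, $S^{t+1} = S^t_{\Delta i\sigma} - \Delta_i$ with probability $|S^t_{\Delta i\sigma}|/|S^t|$. -}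

module Defs where

open import Level using (0ℓ)
open import Data.Nat as ℕ using (ℕ)
open import Data.Integer using (ℤ; +_; -_; _+_; _-_; _≤_; _<_; ∣_∣; 0ℤ; 1ℤ; -1ℤ)
open import Data.List using (List)
open import Data.List.Membership.Propositional using (_∈_)
open import Data.Product using (Σ; ∃; _×_; _,_)
open import Data.Sum using (_⊎_)
open import Relation.Unary using (Pred)
open import Relation.Nullary using (¬_)
open import Relation.Binary.PropositionalEquality using (_≡_)

ZSet : Set₁
ZSet = Pred ℤ 0ℓ

_≐_ : ZSet → ZSet → Set
S ≐ T = ∀ x → (S x → T x) × (T x → S x)

Zero : ZSet
Zero x = x ≡ 0ℤ

Interval : ℤ → ℤ → ZSet
Interval a b x = (a ≤ x) × (x ≤ b)

-- Link-offset sets: a finite set (given as a list) of nonzero integers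
-- containing -1 and +1.
record ValidΔ (Δ : List ℤ) : Set where
  field
    nonzero : ∀ {δ} → δ ∈ Δ → ¬ (δ ≡ 0ℤ)
    has-1   : -1ℤ ∈ Δ
    has+1   : 1ℤ ∈ Δ

data Sgn : Set where
  neg zer pos : Sgn

sgn : ℤ → Sgn
sgn (+ ℕ.zero)  = zer
sgn (+ ℕ.suc _) = pos
sgn _           = neg

-- A routing rule: Route Δ x y means "s(x,Δ) = y".
Route : Set₁
Route = List ℤ → ℤ → ℤ → Set

OneSided : Route
OneSided Δ x y =
  Σ ℤ λ δ → (δ ∈ Δ) × (y ≡ x - δ) × (0ℤ ≤ y) ×
    (∀ δ' → δ' ∈ Δ → 0ℤ ≤ x - δ' → y ≤ x - δ')

TieRule : Set
TieRule = List ℤ → ℤ → ℤ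

IsTwoSidedRule : (List ℤ → ℤ → ℤ) → Set
IsTwoSidedRule tb = ∀ Δ → ValidΔ Δ → ∀ x →
  Σ ℤ λ δ → (δ ∈ Δ) × (tb Δ x ≡ x - δ) ×
    (∀ δ' → δ' ∈ Δ → ∣ tb Δ x ∣ ℕ.≤ ∣ x - δ' ∣)

TwoSided : (List ℤ → ℤ → ℤ) → Route
TwoSided tb Δ x y = y ≡ tb Δ x

-- One step of the aggregate chain with positive probability.
-- If S = {0} the next set is {0}.  Otherwise for some offset set Δ, some
-- δ = Δ_i ∈ Δ and some sign σ with S_{Δiσ} nonempty (positive probability
-- |S_{Δiσ}|/|S|), the next set is S_{Δiσ} - δ, i.e. the set of y such that
-- x = y + δ ∈ S, s(x,Δ) = x - δ = y, and sgn y = σ.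
data Step (R : Route) (S : ZSet) : ZSet → Set₁ where
  absorb : ∀ {S'} → S ≐ Zero → S' ≐ Zero → Step R S S'
  move   : ∀ {S'} → ¬ (S ≐ Zero) →
           (Δ : List ℤ) → ValidΔ Δ → (δ : ℤ) → δ ∈ Δ → (σ : Sgn) →
           (∃ λ x → S x × R Δ x (x - δ) × (sgn (x - δ) ≡ σ)) →
           S' ≐ (λ y → S (y + δ) × R Δ (y + δ) y × (sgn y ≡ σ)) →
           Step R S S'

-- S is a possible value of S^t for some t (reachable with positive
-- probability) starting from S^0 = S0.
data Reachable (R : Route) (S0 : ZSet) : ZSet → Set₁ where
  start : ∀ {S} → S ≐ S0 → Reachable R S0 S
  next  : ∀ {S S'} → Reachable R S0 S → Step R S S' → Reachable R S0 S'

{-# OPTIONS --safe #-}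
-- Write S' = {y : y + δ ∈ S, s(y + δ) = y, sgn y = σ} for one move of the chain
-- along the offset δ.  The nodes reached by a move along δ form a set that is
-- star-shaped about the target 0: if z is reached and y lies between 0 and z,
-- then y is reached too.  With one-sided routing, δ stays the largest usable
-- offset as the node moves toward 0; with two-sided routing, a nearer neighbour
-- of y + δ, shifted by z - y, would be a nearer neighbour of z + δ.  Hence S' is
-- the intersection of three order-convex sets (a shift of S, that star-shaped
-- set, and a sign class), and being bounded, decidable and nonempty it is an
-- interval of one sign.  One-sided routing never lands below 0, and a positive
-- S' contains 1 because a positive node routes along an offset ≥ 1.
module Submission where

open import Defs
open import Data.Nat using (ℕ)
open import Data.Integer using (ℤ; +_; _≤_; _<_; 0ℤ; 1ℤ)
open import Data.Product using (Σ; ∃; _×_)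
open import Data.Sum using (_⊎_)
open import Relation.Binary.PropositionalEquality using (_≡_)

import Data.Nat as ℕ
open import Data.Integer using (-_; _+_; _-_; ∣_∣; +≤+; -≤+; +<+; -<+; -[1+_])
open import Data.Integer.Properties
open import Data.Integer.Tactic.RingSolver using (solve-∀)
open import Data.List using (List)
open import Data.List.Membership.Propositional using (_∈_)
open import Data.List.Relation.Unary.All as All using (All)
open import Data.Product using (_,_; proj₁; proj₂; ∃₂; swap)
open import Data.Sum using (inj₁; inj₂; [_,_]′)
open import Data.Empty using (⊥-elim)
open import Function using (_∘_)
open import Relation.Binary.Definitions using (DecidableEquality)
open import Relation.Binary.PropositionalEquality using (refl; sym; trans; cong; subst; subst₂; _≢_)
open import Relation.Binary.PropositionalEquality using (module ≡-Reasoning)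
open import Relation.Nullary using (yes; no)
open import Relation.Nullary.Decidable using (map′; _×-dec_; _→-dec_)
open import Relation.Unary using (Decidable; Satisfiable; _⊆_; _∩_)
open import Relation.Unary.Properties using (_∩?_)

variable
  a b lo hi v w x y z δ : ℤ
  k : ℕ
  Δ : List ℤ
  tb : TieRule
  P Q S S′ : ZSet
  R : Route
  σ : Sgn

[i+j]-j≡i : ∀ i j → (i + j) - j ≡ i
[i+j]-j≡i = solve-∀

[i-j]+j≡i : ∀ i j → (i - j) + j ≡ i
[i-j]+j≡i = solve-∀

i+[j-i]≡j : ∀ i j → i + (j - i) ≡ j
i+[j-i]≡j = solve-∀

i-[i-j]≡j : ∀ i j → i - (i - j) ≡ j
i-[i-j]≡j = solve-∀

[i+j-k]-i≡j-k : ∀ i j k → ((i + j) - k) - i ≡ j - k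
[i+j-k]-i≡j-k = solve-∀

[i+[j-k]]-j≡i-k : ∀ i j k → (i + (j - k)) - j ≡ i - k
[i+[j-k]]-j≡i-k = solve-∀

-[i+[j-k]]+j≡k-i : ∀ i j k → - (i + (j - k)) + j ≡ k - i
-[i+[j-k]]+j≡k-i = solve-∀

-i+[-j--k]≡-[i+[j-k]] : ∀ i j k → - i + (- j - - k) ≡ - (i + (j - k))
-i+[-j--k]≡-[i+[j-k]] = solve-∀

[i+j]-k≡[[l+j]-k]+[i-l] : ∀ i j k l → (i + j) - k ≡ ((l + j) - k) + (i - l)
[i+j]-k≡[[l+j]-k]+[i-l] = solve-∀

i≤[i+j]-k⇒k≤j : ∀ {i j k} → i ≤ (i + j) - k → k ≤ j
i≤[i+j]-k⇒k≤j {i} {j} {k} le = 0≤i-j⇒j≤i (subst (0ℤ ≤_) ([i+j-k]-i≡j-k i j k) (i≤j⇒0≤j-i le))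

k≤j⇒i≤[i+j]-k : ∀ {i j k} → k ≤ j → i ≤ (i + j) - k
k≤j⇒i≤[i+j]-k {i} {j} {k} le = 0≤i-j⇒j≤i (subst (0ℤ ≤_) (sym ([i+j-k]-i≡j-k i j k)) (i≤j⇒0≤j-i le))

i≡[i+j]-k⇒k≡j : ∀ {i j k} → i ≡ (i + j) - k → k ≡ j
i≡[i+j]-k⇒k≡j {i} {j} {k} eq = begin
  k                       ≡⟨ sym (i-[i-j]≡j (i + j) k) ⟩
  (i + j) - ((i + j) - k) ≡⟨ cong (λ u → (i + j) - u) (sym eq) ⟩
  (i + j) - i             ≡⟨ cong (_- i) (+-comm i j) ⟩
  (j + i) - i             ≡⟨ [i+j]-j≡i j i ⟩
  j                       ∎
  where open ≡-Reasoning

≐-trans : P ≐ Q → Q ≐ S → P ≐ S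
≐-trans P≐Q Q≐S x = proj₁ (Q≐S x) ∘ proj₁ (P≐Q x) , proj₂ (P≐Q x) ∘ proj₂ (Q≐S x)

Zero≐Interval0 : Zero ≐ Interval 0ℤ 0ℤ
Zero≐Interval0 x = (λ { refl → ≤-refl , ≤-refl }) , λ (x≤0 , 0≤x) → ≤-antisym 0≤x x≤0

Interval? : ∀ a b → Decidable (Interval a b)
Interval? a b x = (a ≤? x) ×-dec (x ≤? b)

Convex : ZSet → Set
Convex P = ∀ {x y z} → x ≤ y → y ≤ z → P x → P z → P y

Interval-convex : Convex (Interval a b)
Interval-convex x≤y y≤z (a≤x , _) (_ , z≤b) = ≤-trans a≤x x≤y , ≤-trans y≤z z≤b

Convex-resp-≐ : P ≐ Q → Convex P → Convex Q
Convex-resp-≐ P≐Q convex x≤y y≤z Qx Qz =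
  proj₁ (P≐Q _) (convex x≤y y≤z (proj₂ (P≐Q _) Qx) (proj₂ (P≐Q _) Qz))

Convex-shift : Convex P → Convex (λ y → P (y + δ))
Convex-shift {δ = δ} convex x≤y y≤z = convex (+-monoˡ-≤ δ x≤y) (+-monoˡ-≤ δ y≤z)

Convex-∩ : Convex P → Convex Q → Convex (P ∩ Q)
Convex-∩ convexP convexQ x≤y y≤z (Px , Qx) (Pz , Qz) =
  convexP x≤y y≤z Px Pz , convexQ x≤y y≤z Qx Qz

greatest-below : Decidable P → ∀ f → P w → P ⊆ (_≤ w + + f) → ∃ λ b → P b × P ⊆ (_≤ b)
greatest-below {w = w} P? ℕ.zero Pw P≤ = w , Pw , subst (_ ≤_) (+-identityʳ w) ∘ P≤
greatest-below {w = w} P? (ℕ.suc f) Pw P≤ with P? (w + + ℕ.suc f)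
... | yes Ptop = _ , Ptop , P≤
... | no ¬Ptop = greatest-below P? f Pw (λ Py → below-top (P≤ Py) λ { refl → ¬Ptop Py })
  where
  below-top : ∀ {y} → y ≤ w + + ℕ.suc f → y ≢ w + + ℕ.suc f → y ≤ w + + f
  below-top y≤ y≢ = subst (_ ≤_) (sym (+-pred w (+ ℕ.suc f))) (i<j⇒i≤pred[j] (≤∧≢⇒< y≤ y≢))

greatest : Decidable P → Satisfiable P → P ⊆ (_≤ hi) → ∃ λ b → P b × P ⊆ (_≤ b)
greatest {hi = hi} P? (w , Pw) P≤hi =
  greatest-below P? ∣ hi - w ∣ Pw (subst (_ ≤_) (sym top≡hi) ∘ P≤hi)
  where
  top≡hi : w + + ∣ hi - w ∣ ≡ hi
  top≡hi = trans (cong (λ u → w + u) (0≤i⇒+∣i∣≡i (i≤j⇒0≤j-i (P≤hi Pw)))) (i+[j-i]≡j w hi)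

least : Decidable P → Satisfiable P → P ⊆ (lo ≤_) → ∃ λ a → P a × P ⊆ (a ≤_)
least {P = P} {lo = lo} P? (w , Pw) lo≤P =
  let b , P-b , ≤b = greatest (P? ∘ -_) (- w , P[--] Pw) (λ {y} P-y → flip≤ y (lo≤P P-y))
  in  - b , P-b , λ {y} Py → subst (- b ≤_) (neg-involutive y) (neg-mono-≤ (≤b (P[--] Py)))
  where
  P[--] : P y → P (- - y)
  P[--] {y} = subst P (sym (neg-involutive y))
  flip≤ : ∀ y → lo ≤ - y → y ≤ - lo
  flip≤ y lo≤-y = subst (_≤ - lo) (neg-involutive y) (neg-mono-≤ lo≤-y)

IsInterval : ZSet → ℤ → ℤ → Set
IsInterval P a b = a ≤ b × P ≐ Interval a b

IsInterval⇒lo∈ : IsInterval P a b → P a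
IsInterval⇒lo∈ {a = a} (a≤b , P≐) = proj₂ (P≐ a) (≤-refl , a≤b)

IsInterval⇒hi∈ : IsInterval P a b → P b
IsInterval⇒hi∈ {b = b} (a≤b , P≐) = proj₂ (P≐ b) (a≤b , ≤-refl)

convex⇒interval : Decidable P → Convex P → P ⊆ Interval lo hi → Satisfiable P →
                  ∃₂ (IsInterval P)
convex⇒interval P? convex P⊆ ∃P =
  let a , Pa , a≤P = least P? ∃P (proj₁ ∘ P⊆)
      b , Pb , P≤b = greatest P? ∃P (proj₂ ∘ P⊆)
  in  a , b , P≤b Pa , λ y → (λ Py → a≤P Py , P≤b Py) , λ (a≤y , y≤b) → convex a≤y y≤b Pa Pb

SignClass : Sgn → ZSet
SignClass σ y = sgn y ≡ σ

sgn≡pos⇒0< : sgn y ≡ pos → 0ℤ < y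
sgn≡pos⇒0< {+ ℕ.suc _} _ = +<+ (ℕ.s≤s ℕ.z≤n)
sgn≡pos⇒0< {+ ℕ.zero} ()
sgn≡pos⇒0< { -[1+ _ ]} ()

0<⇒sgn≡pos : 0ℤ < y → sgn y ≡ pos
0<⇒sgn≡pos {+ ℕ.suc _} _ = refl
0<⇒sgn≡pos {+ ℕ.zero} (+<+ ())

sgn≡neg⇒<0 : sgn y ≡ neg → y < 0ℤ
sgn≡neg⇒<0 { -[1+ _ ]} _ = -<+
sgn≡neg⇒<0 {+ ℕ.zero} ()
sgn≡neg⇒<0 {+ ℕ.suc _} ()

<0⇒sgn≡neg : y < 0ℤ → sgn y ≡ neg
<0⇒sgn≡neg { -[1+ _ ]} _ = refl
<0⇒sgn≡neg {+ _} (+<+ ())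

sgn≡zer⇒≡0 : sgn y ≡ zer → y ≡ 0ℤ
sgn≡zer⇒≡0 {+ ℕ.zero} _ = refl
sgn≡zer⇒≡0 {+ ℕ.suc _} ()
sgn≡zer⇒≡0 { -[1+ _ ]} ()

_≟ˢ_ : DecidableEquality Sgn
neg ≟ˢ neg = yes refl
zer ≟ˢ zer = yes refl
pos ≟ˢ pos = yes refl
neg ≟ˢ zer = no λ ()
neg ≟ˢ pos = no λ ()
zer ≟ˢ neg = no λ ()
zer ≟ˢ pos = no λ ()
pos ≟ˢ neg = no λ ()
pos ≟ˢ zer = no λ ()

SignClass-convex : ∀ σ → Convex (SignClass σ)
SignClass-convex neg _ y≤z _ z- = <0⇒sgn≡neg (≤-<-trans y≤z (sgn≡neg⇒<0 z-))
SignClass-convex pos x≤y _ x+ _ = 0<⇒sgn≡pos (<-≤-trans (sgn≡pos⇒0< x+) x≤y)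
SignClass-convex zer {x} {y} {z} x≤y y≤z x0 z0 = cong sgn y≡0
  where
  y≡0 : y ≡ 0ℤ
  y≡0 = ≤-antisym (subst (y ≤_) (sgn≡zer⇒≡0 z0) y≤z) (subst (_≤ y) (sgn≡zer⇒≡0 x0) x≤y)

OneSigned : ℤ → ℤ → Set
OneSigned a b = (0ℤ < a) ⊎ (b < 0ℤ) ⊎ ((a ≡ 0ℤ) × (b ≡ 0ℤ))

sgn≡⇒OneSigned : ∀ σ → sgn a ≡ σ → sgn b ≡ σ → OneSigned a b
sgn≡⇒OneSigned pos a+ _  = inj₁ (sgn≡pos⇒0< a+)
sgn≡⇒OneSigned neg _  b- = inj₂ (inj₁ (sgn≡neg⇒<0 b-))
sgn≡⇒OneSigned zer a0 b0 = inj₂ (inj₂ (sgn≡zer⇒≡0 a0 , sgn≡zer⇒≡0 b0))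

⊆Zero⇒≐Zero : P ⊆ Zero → Satisfiable P → P ≐ Zero
⊆Zero⇒≐Zero {P = P} P⊆0 (w , Pw) y = P⊆0 , λ { refl → subst P (P⊆0 Pw) Pw }

Landing : Route → List ℤ → ℤ → ZSet
Landing R Δ δ y = R Δ (y + δ) y

record StarShaped (L : ZSet) : Set where
  field
    toward0⁺ : ∀ {y z} → 0ℤ ≤ y → y ≤ z → L z → L y
    toward0⁻ : ∀ {x y} → y ≤ 0ℤ → x ≤ y → L x → L y

open StarShaped

StarShaped⇒Convex : StarShaped P → Convex P
StarShaped⇒Convex P* {y = y} x≤y y≤z Px Pz with 0ℤ ≤? y
... | yes 0≤y = toward0⁺ P* 0≤y y≤z Pz
... | no  0≰y = toward0⁻ P* (<⇒≤ (≰⇒> 0≰y)) x≤y Px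

oneSided-landing? : δ ∈ Δ → Decidable (Landing OneSided Δ δ)
oneSided-landing? {δ = δ} {Δ = Δ} δ∈ y =
  map′ from to ((0ℤ ≤? y) ×-dec All.all? (λ d → (0ℤ ≤? (y + δ) - d) →-dec (y ≤? (y + δ) - d)) Δ)
  where
  Nearest : ℤ → Set
  Nearest d = 0ℤ ≤ (y + δ) - d → y ≤ (y + δ) - d
  from : 0ℤ ≤ y × All Nearest Δ → Landing OneSided Δ δ y
  from (0≤y , nearest) = δ , δ∈ , sym ([i+j]-j≡i y δ) , 0≤y , λ _ d∈ → All.lookup nearest d∈
  to : Landing OneSided Δ δ y → 0ℤ ≤ y × All Nearest Δ
  to (_ , _ , _ , 0≤y , nearest) = 0≤y , All.tabulate (nearest _)

oneSided-starShaped : StarShaped (Landing OneSided Δ δ)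
toward0⁺ (oneSided-starShaped {Δ = Δ} {δ = δ}) {y} {z} 0≤y y≤z (d , d∈ , z≡ , _ , nearest) =
  d , d∈ , y≡ , 0≤y , λ d′ d′∈ 0≤ → k≤j⇒i≤[i+j]-k (d′≤δ d′ d′∈ 0≤)
  where
  y≡ : y ≡ (y + δ) - d
  y≡ = trans (sym ([i+j]-j≡i y δ)) (cong (λ u → (y + δ) - u) (sym (i≡[i+j]-k⇒k≡j z≡)))
  d′≤δ : ∀ d′ → d′ ∈ Δ → 0ℤ ≤ (y + δ) - d′ → d′ ≤ δ
  d′≤δ d′ d′∈ 0≤ =
    i≤[i+j]-k⇒k≤j (nearest d′ d′∈ (≤-trans 0≤ (+-monoˡ-≤ (- d′) (+-monoˡ-≤ δ y≤z))))
toward0⁻ (oneSided-starShaped {Δ = Δ} {δ = δ}) y≤0 x≤y Lx@(_ , _ , _ , 0≤x , _) =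
  subst (Landing OneSided Δ δ) (≤-antisym x≤y (≤-trans y≤0 0≤x)) Lx

oneSided-offset≥1 : 1ℤ ∈ Δ → 1ℤ ≤ y + δ → Landing OneSided Δ δ y → 1ℤ ≤ δ
oneSided-offset≥1 1∈ 1≤y+δ (_ , _ , _ , _ , nearest) =
  i≤[i+j]-k⇒k≤j (nearest 1ℤ 1∈ (i≤j⇒0≤j-i 1≤y+δ))

i≤+∣i∣ : ∀ i → i ≤ + ∣ i ∣
i≤+∣i∣ (+ _)    = ≤-refl
i≤+∣i∣ -[1+ _ ] = -≤+

-i≤+∣i∣ : ∀ i → - i ≤ + ∣ i ∣
-i≤+∣i∣ i = subst (λ n → - i ≤ + n) (∣-i∣≡∣i∣ i) (i≤+∣i∣ (- i))

-- Shifting by t = z - y > 0 moves y ≥ 0 exactly t away from 0, and any v ≠ y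
-- with ∣ v ∣ ≤ y strictly less.
shift-rigid⁺ : 0ℤ ≤ y → y < z → ∣ v ∣ ℕ.≤ ∣ y ∣ → ∣ z ∣ ℕ.≤ ∣ v + (z - y) ∣ → v ≡ y
shift-rigid⁺ {y} {z} {v} 0≤y y<z ∣v∣≤∣y∣ ∣z∣≤∣u∣ = [ u-nonneg , u-neg ]′ (+∣i∣≡i⊎+∣i∣≡-i u)
  where
  u : ℤ
  u = v + (z - y)
  ∣v∣≤y : + ∣ v ∣ ≤ y
  ∣v∣≤y = subst (+ ∣ v ∣ ≤_) (0≤i⇒+∣i∣≡i 0≤y) (+≤+ ∣v∣≤∣y∣)
  z≤∣u∣ : z ≤ + ∣ u ∣
  z≤∣u∣ = subst (_≤ + ∣ u ∣) (0≤i⇒+∣i∣≡i (≤-trans 0≤y (<⇒≤ y<z))) (+≤+ ∣z∣≤∣u∣)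
  u-nonneg : + ∣ u ∣ ≡ u → v ≡ y
  u-nonneg ∣u∣≡u = ≤-antisym (≤-trans (i≤+∣i∣ v) ∣v∣≤y) (0≤i-j⇒j≤i 0≤v-y)
    where
    0≤v-y : 0ℤ ≤ v - y
    0≤v-y = subst (0ℤ ≤_) ([i+[j-k]]-j≡i-k v z y) (i≤j⇒0≤j-i (subst (z ≤_) ∣u∣≡u z≤∣u∣))
  u-neg : + ∣ u ∣ ≡ - u → v ≡ y
  u-neg ∣u∣≡-u = ⊥-elim (<⇒≱ (+-mono-< y<z y<z) (≤-trans z+z≤y-v y-v≤y+y))
    where
    z+z≤y-v : z + z ≤ y - v
    z+z≤y-v = subst (z + z ≤_) (-[i+[j-k]]+j≡k-i v z y) (+-monoˡ-≤ z (subst (z ≤_) ∣u∣≡-u z≤∣u∣))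
    y-v≤y+y : y - v ≤ y + y
    y-v≤y+y = +-monoʳ-≤ y (≤-trans (-i≤+∣i∣ v) ∣v∣≤y)

shift-rigid⁻ : y ≤ 0ℤ → x < y → ∣ v ∣ ℕ.≤ ∣ y ∣ → ∣ x ∣ ℕ.≤ ∣ v + (x - y) ∣ → v ≡ y
shift-rigid⁻ {y} {x} {v} y≤0 x<y ∣v∣≤∣y∣ ∣x∣≤∣u∣ =
  neg-injective (shift-rigid⁺ (neg-mono-≤ y≤0) (neg-mono-< x<y) ∣-v∣≤∣-y∣ ∣-x∣≤∣-u∣)
  where
  ∣-v∣≤∣-y∣ : ∣ - v ∣ ℕ.≤ ∣ - y ∣
  ∣-v∣≤∣-y∣ = subst₂ ℕ._≤_ (sym (∣-i∣≡∣i∣ v)) (sym (∣-i∣≡∣i∣ y)) ∣v∣≤∣y∣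
  ∣-x∣≤∣-u∣ : ∣ - x ∣ ℕ.≤ ∣ - v + (- x - - y) ∣
  ∣-x∣≤∣-u∣ = subst₂ ℕ._≤_ (sym (∣-i∣≡∣i∣ x))
                (trans (sym (∣-i∣≡∣i∣ (v + (x - y))))
                       (cong ∣_∣ (sym (-i+[-j--k]≡-[i+[j-k]] v x y))))
                ∣x∣≤∣u∣

module _ {tb : TieRule} (greedy : IsTwoSidedRule tb) {Δ : List ℤ} {δ : ℤ}
         (valid : ValidΔ Δ) (δ∈ : δ ∈ Δ) where

  twoSided-nearest-bounds : Landing (TwoSided tb) Δ δ w →
                    ∣ tb Δ (y + δ) ∣ ℕ.≤ ∣ y ∣ × ∣ w ∣ ℕ.≤ ∣ tb Δ (y + δ) + (w - y) ∣
  twoSided-nearest-bounds {w} {y} w≡ with greedy Δ valid (y + δ) | greedy Δ valid (w + δ)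
  ... | d , d∈ , tb≡ , nearestʸ | _ , _ , _ , nearestʷ =
    subst (λ u → ∣ tb Δ (y + δ) ∣ ℕ.≤ ∣ u ∣) ([i+j]-j≡i y δ) (nearestʸ δ δ∈) ,
    subst₂ (λ u u′ → ∣ u ∣ ℕ.≤ ∣ u′ ∣) (sym w≡)
      (trans ([i+j]-k≡[[l+j]-k]+[i-l] w δ d y) (cong (_+ (w - y)) (sym tb≡))) (nearestʷ d d∈)

  twoSided-starShaped : StarShaped (Landing (TwoSided tb) Δ δ)
  toward0⁺ twoSided-starShaped {y} {z} 0≤y y≤z Lz with y ≟ z
  ... | yes refl = Lz
  ... | no y≢z   = let ∣v∣≤∣y∣ , ∣z∣≤ = twoSided-nearest-bounds Lz
                   in sym (shift-rigid⁺ 0≤y (≤∧≢⇒< y≤z y≢z) ∣v∣≤∣y∣ ∣z∣≤)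
  toward0⁻ twoSided-starShaped {x} {y} y≤0 x≤y Lx with x ≟ y
  ... | yes refl = Lx
  ... | no x≢y   = let ∣v∣≤∣y∣ , ∣x∣≤ = twoSided-nearest-bounds Lx
                   in sym (shift-rigid⁻ y≤0 (≤∧≢⇒< x≤y x≢y) ∣v∣≤∣y∣ ∣x∣≤)

StepSet : Route → ZSet → List ℤ → ℤ → Sgn → ZSet
StepSet R S Δ δ σ = (λ y → S (y + δ)) ∩ Landing R Δ δ ∩ SignClass σ

StepSet-nonempty : (∃ λ x → S x × R Δ x (x - δ) × (sgn (x - δ) ≡ σ)) →
                   Satisfiable (StepSet R S Δ δ σ)
StepSet-nonempty {S = S} {R = R} {Δ = Δ} {δ = δ} (x , Sx , Rx , σx) =
  let Sx′ , Rx′ = subst (λ u → S u × R Δ u (x - δ)) (sym ([i-j]+j≡i x δ)) (Sx , Rx)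
  in  x - δ , Sx′ , Rx′ , σx

StepSet-interval : S ≐ Interval a b → Decidable (Landing R Δ δ) → StarShaped (Landing R Δ δ) →
                   Satisfiable (StepSet R S Δ δ σ) → ∃₂ (IsInterval (StepSet R S Δ δ σ))
StepSet-interval {S = S} {a = a} {b = b} {δ = δ} {σ = σ} S≐ L? L* =
  convex⇒interval (S? ∩? L? ∩? (λ y → sgn y ≟ˢ σ))
    (Convex-∩ (Convex-shift (Convex-resp-≐ (swap ∘ S≐) Interval-convex))
      (Convex-∩ (StarShaped⇒Convex L*) (SignClass-convex σ)))
    (λ (Sy+δ , _) → let a≤ , ≤b = proj₁ (S≐ _) Sy+δ in lower a≤ , upper ≤b)
  where
  S? : Decidable (λ y → S (y + δ))
  S? y = map′ (proj₂ (S≐ (y + δ))) (proj₁ (S≐ (y + δ))) (Interval? a b (y + δ))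
  lower : a ≤ y + δ → a - δ ≤ y
  lower {y} a≤ = subst (a - δ ≤_) ([i+j]-j≡i y δ) (+-monoˡ-≤ (- δ) a≤)
  upper : y + δ ≤ b → y ≤ b - δ
  upper {y} ≤b = subst (_≤ b - δ) ([i+j]-j≡i y δ) (+-monoˡ-≤ (- δ) ≤b)

Reachable-invariant : {S₀ : ZSet} (I : ZSet → Set) → (∀ {S} → S ≐ S₀ → I S) →
                      (∀ {S S′} → I S → Step R S S′ → I S′) → Reachable R S₀ S → I S
Reachable-invariant I start-I step-I (start S≐) = start-I S≐
Reachable-invariant I start-I step-I (next r s) = step-I (Reachable-invariant I start-I step-I r) s

ZeroOrInitialSegment : ZSet → Set
ZeroOrInitialSegment S = (S ≐ Zero) ⊎ (Σ ℕ λ k → (1ℤ ≤ + k) × (S ≐ Interval 1ℤ (+ k)))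

oneSided-initialSegment : ValidΔ Δ → δ ∈ Δ → S ≐ Interval 1ℤ (+ k) →
                          Satisfiable (StepSet OneSided S Δ δ pos) →
                          Σ ℕ λ m → (1ℤ ≤ + m) × (StepSet OneSided S Δ δ pos ≐ Interval 1ℤ (+ m))
oneSided-initialSegment {Δ = Δ} {δ = δ} {S = S} {k = k} valid δ∈ S≐ ne
  with StepSet-interval {R = OneSided} S≐ (oneSided-landing? δ∈) oneSided-starShaped ne
... | a , b , a≤b , P≐ =
  ∣ b ∣ , subst (1ℤ ≤_) (sym +∣b∣≡b) 1≤b , subst₂ (λ u u′ → _ ≐ Interval u u′) a≡1 (sym +∣b∣≡b) P≐
  where
  Pa : StepSet OneSided S Δ δ pos a
  Pa = IsInterval⇒lo∈ (a≤b , P≐)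
  1≤a : 1ℤ ≤ a
  1≤a = i<j⇒suc[i]≤j (sgn≡pos⇒0< (proj₂ (proj₂ Pa)))
  a+δ∈ : Interval 1ℤ (+ k) (a + δ)
  a+δ∈ = proj₁ (S≐ (a + δ)) (proj₁ Pa)
  1≤δ : 1ℤ ≤ δ
  1≤δ = oneSided-offset≥1 (ValidΔ.has+1 valid) (proj₁ a+δ∈) (proj₁ (proj₂ Pa))
  P1 : StepSet OneSided S Δ δ pos 1ℤ
  P1 = proj₂ (S≐ (1ℤ + δ)) (≤-trans 1≤δ (i≤j+i δ 1ℤ) , ≤-trans (+-monoˡ-≤ δ 1≤a) (proj₂ a+δ∈)) ,
       toward0⁺ oneSided-starShaped (+≤+ ℕ.z≤n) 1≤a (proj₁ (proj₂ Pa)) , refl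
  a≡1 : a ≡ 1ℤ
  a≡1 = ≤-antisym (proj₁ (proj₁ (P≐ 1ℤ) P1)) 1≤a
  1≤b : 1ℤ ≤ b
  1≤b = ≤-trans 1≤a a≤b
  +∣b∣≡b : + ∣ b ∣ ≡ b
  +∣b∣≡b = 0≤i⇒+∣i∣≡i (≤-trans (+≤+ ℕ.z≤n) 1≤b)

oneSided-move : ValidΔ Δ → δ ∈ Δ → S ≐ Interval 1ℤ (+ k) → ∀ σ →
                Satisfiable (StepSet OneSided S Δ δ σ) → S′ ≐ StepSet OneSided S Δ δ σ →
                ZeroOrInitialSegment S′
oneSided-move _ _ _ neg (_ , _ , (_ , _ , _ , 0≤y , _) , y-) _ = ⊥-elim (<⇒≱ (sgn≡neg⇒<0 y-) 0≤y)
oneSided-move _ _ _ zer ne S′≐ = inj₁ (≐-trans S′≐ (⊆Zero⇒≐Zero (sgn≡zer⇒≡0 ∘ proj₂ ∘ proj₂) ne))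
oneSided-move valid δ∈ S≐ pos ne S′≐ =
  let m , 1≤m , P≐ = oneSided-initialSegment valid δ∈ S≐ ne in inj₂ (m , 1≤m , ≐-trans S′≐ P≐)

oneSided-step : ZeroOrInitialSegment S → Step OneSided S S′ → ZeroOrInitialSegment S′
oneSided-step _ (absorb _ S′≐0) = inj₁ S′≐0
oneSided-step (inj₁ S≐0) (move S≭0 _ _ _ _ _ _ _) = ⊥-elim (S≭0 S≐0)
oneSided-step (inj₂ (_ , _ , S≐)) (move _ _ valid _ δ∈ σ moves S′≐) =
  oneSided-move valid δ∈ S≐ σ (StepSet-nonempty {R = OneSided} moves) S′≐

SignedInterval : ZSet → Set
SignedInterval S = Σ ℤ λ a → Σ ℤ λ b → (a ≤ b) × (S ≐ Interval a b) × OneSigned a b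

twoSided-step : IsTwoSidedRule tb → SignedInterval S → Step (TwoSided tb) S S′ → SignedInterval S′
twoSided-step _ _ (absorb _ S′≐0) =
  0ℤ , 0ℤ , ≤-refl , ≐-trans S′≐0 Zero≐Interval0 , inj₂ (inj₂ (refl , refl))
twoSided-step {tb = tb} greedy (_ , _ , _ , S≐ , _) (move _ Δ valid δ δ∈ σ moves S′≐) =
  let a , b , I = StepSet-interval {R = TwoSided tb} S≐ (λ y → y ≟ tb Δ (y + δ))
                    (twoSided-starShaped greedy valid δ∈) (StepSet-nonempty {R = TwoSided tb} moves)
  in  a , b , proj₁ I , ≐-trans S′≐ (proj₂ I) ,
      sgn≡⇒OneSigned σ (proj₂ (proj₂ (IsInterval⇒lo∈ I))) (proj₂ (proj₂ (IsInterval⇒hi∈ I)))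

lemma3 : ((n : ℕ) → 1ℤ ≤ + n → (S : ZSet) → Reachable OneSided (Interval 1ℤ (+ n)) S →
           (S ≐ Zero) ⊎ (Σ ℕ λ k → (1ℤ ≤ + k) × (S ≐ Interval 1ℤ (+ k))))
         × ((tb : TieRule) → IsTwoSidedRule tb → (n : ℕ) → 1ℤ ≤ + n → (S : ZSet) →
           Reachable (TwoSided tb) (Interval 1ℤ (+ n)) S →
           Σ ℤ λ a → Σ ℤ λ b → (a ≤ b) × (S ≐ Interval a b) ×
             ((0ℤ < a) ⊎ (b < 0ℤ) ⊎ ((a ≡ 0ℤ) × (b ≡ 0ℤ))))
lemma3 =
  (λ n 1≤n _ → Reachable-invariant ZeroOrInitialSegment
                 (λ S≐ → inj₂ (n , 1≤n , S≐))
                 oneSided-step) ,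
  (λ tb greedy n 1≤n _ → Reachable-invariant SignedInterval
                           (λ S≐ → 1ℤ , + n , 1≤n , S≐ , inj₁ (+<+ (ℕ.s≤s ℕ.z≤n)))
                           (twoSided-step greedy))
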